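{- Let $Q_1,Q_2$ be sets of snapshots with disjoint domains such that, for each $i\in\{1,2\}$, $Q_i$ has no nonempty finalized subset and every actor of $\mathrm{dom}(Q_i)$ is potentially finalized in $Q_i$. Let $i\in\{1,2\}$ and let $B\in\mathrm{dom}(Q_i)$ be an actor that is not a receptionist in $Q_i$. Then $B$ is finalized in $Q_1\cup Q_2$ if and only if every receptionist in $Q_i$ on which $B$ depends in $Q_i$ is finalized in $Q_1\cup Q_2$.
   Context: A refob is a triple $(x,A,B)$ of a token $x$, owner actor $A$ and target actor $B$, written $x: A\to B$. A fact is one of $\mathrm{Created}(x)$, $\mathrm{Released}(x)$, $\mathrm{CreatedUsing}(x,y)$, $\mathrm{Activated}(x)$, $\mathrm{Unreleased}(x)$, $\mathrm{SentCount}(x,n)$, $\mathrm{RecvCount}(x,n)$ ($n\in\mathbb N$). A knowledge set $\Phi$ is a finite set of facts; $\Phi\vdash\varphi$ means $\varphi$ is derivable from $\Phi$ in first-order logic plus the rules: if no $\mathrm{SentCount}(x,n)\in\Phi$ then $\Phi\vdash\mathrm{SentCount}(x,0)$; if no $\mathrm{RecvCount}(x,n)\in\Phi$ then $\Phi\vdash\mathrm{RecvCount}(x,0)$; if $\Phi\vdash\mathrm{Created}(x)$ and $\Phi\not\vdash\mathrm{Released}(x)$ then $\Phi\vdash\mathrm{Unreleased}(x)$; if $\Phi\vdash\mathrm{CreatedUsing}(x,y)$ then $\Phi\vdash\mathrm{Created}(y)$. A set of snapshots $Q$ is a finite partial map from actors to knowledge sets; unions are unions of partial maps and subsets are restrictions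 to subsets of the domain. For a refob $x:A\to B$: $Q\vdash\mathrm{Activated}(x)$, $Q\vdash\mathrm{SentCount}(x,n)$, $Q\vdash\mathrm{CreatedUsing}(x,y)$ mean $A\in\mathrm{dom}(Q)$ and $Q(A)$ derives the fact; $Q\vdash\mathrm{Created}(x)$, $Q\vdash\mathrm{Released}(x)$, $Q\vdash\mathrm{RecvCount}(x,n)$ mean $B\in\mathrm{dom}(Q)$ and $Q(B)$ derives the fact. $Q\vdash\mathrm{Chain}(x:A\to B)$ iff there are refobs $x_1:A_1\to B,\dots,x_n:A_n\to B$ with $Q\vdash\mathrm{Created}(x_1)$, $Q\not\vdash\mathrm{Released}(x_1)$, for all $i<n$ $Q\vdash\mathrm{CreatedUsing}(x_i,x_{i+1})$ and $Q\not\vdash\mathrm{Released}(x_{i+1})$, and $A_n=A$, $x_n=x$. $Q\vdash\mathrm{Relevant}(x)$ iff for some $n$, $Q\vdash\mathrm{Activated}(x)$, $Q\vdash\mathrm{SentCount}(x,n)$ and $Q\vdash\mathrm{RecvCount}(x,n)$. $Q$ is finalized if for all $B\in\mathrm{dom}(Q)$ and all refobs $x:A\to B$, $Q\vdash\mathrm{Chain}(x)$ implies $A\in\mathrm{dom}(Q)$ and $Q\vdash\mathrm{Relevant}(x)$. $B$ depends on $A$ in $Q$ if $A=B$ or there is a sequence of refobs $x_1:A_1\to A_2,\dots,x_{n-1}:A_{n-1}\to A_n$ ($n\ge2$) with $A_1=A$, $A_n=B$ and $Q\vdash\mathrm{Chain}(x_i)$ for each $i<n$. An actor $C$ is finalized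 in $Q$ if for every $B$ on which $C$ depends in $Q$ and every refob $x:A\to B$, $Q\vdash\mathrm{Chain}(x)$ implies $Q\vdash\mathrm{Relevant}(x)$. $C$ is potentially finalized in $Q$ if for every $B$ on which $C$ depends in $Q$ and every refob $x:A\to B$, $Q\vdash\mathrm{Chain}(x)$ implies $Q\vdash\mathrm{Relevant}(x)$ or $A\notin\mathrm{dom}(Q)$. $B$ is a receptionist in $Q$ if $B\in\mathrm{dom}(Q)$ and there is a refob $x:A\to B$ with $Q\vdash\mathrm{Chain}(x)$ and $A\notin\mathrm{dom}(Q)$. -}

module Defs where

open import Data.Nat using (ℕ; zero)
open import Data.List using (List; _++_)
open import Data.List.Membership.Propositional using (_∈_; _∉_)
open import Data.List.Membership.Propositional.Properties using (∈-++⁺ˡ; ∈-++⁺ʳ)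
open import Data.Maybe using (Maybe; just; nothing)
open import Data.Product using (Σ; ∃; _×_; _,_)
open import Data.Sum using (_⊎_)
open import Data.Fin using (Fin; zero; suc)
open import Relation.Binary.PropositionalEquality using (_≡_; refl)
open import Relation.Nullary using (¬_)

module Model (Token Actor : Set) where

  record Refob : Set where
    constructor _∶_⇒_
    field
      token  : Token
      owner  : Actor
      target : Actor
  open Refob public

  data Fact : Set where
    Created      : Token → Fact
    Released     : Token → Fact
    CreatedUsing : Token → Token → Fact
    Activated    : Token → Fact
    Unreleased   : Token → Fact
    SentCount    : Token → ℕ → Fact
    RecvCount    : Token → ℕ → Fact

  Knowledge : Set
  Knowledge = List Fact

  -- Facts are atoms, so first-order derivability of a fact
  -- from Φ is membership closed under the listed rules.  The Unreleased rule
  -- refers negatively to derivability; it is stratified: ⊢₀ is the closure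
  -- under all rules except the Unreleased rule (which is the only rule with a
  -- negative premise and whose conclusion feeds no other rule).
  data _⊢₀_ (Φ : Knowledge) : Fact → Set where
    axiom     : ∀ {φ} → φ ∈ Φ → Φ ⊢₀ φ
    sent-zero : ∀ {x} → (∀ n → SentCount x n ∉ Φ) → Φ ⊢₀ SentCount x 0
    recv-zero : ∀ {x} → (∀ n → RecvCount x n ∉ Φ) → Φ ⊢₀ RecvCount x 0
    using⇒created : ∀ {x y} → Φ ⊢₀ CreatedUsing x y → Φ ⊢₀ Created y

  data _⊢_ (Φ : Knowledge) : Fact → Set where
    base       : ∀ {φ} → Φ ⊢₀ φ → Φ ⊢ φ
    unreleased : ∀ {x} → Φ ⊢₀ Created x → ¬ (Φ ⊢₀ Released x) → Φ ⊢ Unreleased x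

  FiniteDom : (Actor → Maybe Knowledge) → Set
  FiniteDom m = ∃ λ (l : List Actor) → ∀ A Φ → m A ≡ just Φ → A ∈ l

  record Snapshots : Set where
    constructor snapshots
    field
      map    : Actor → Maybe Knowledge
      finite : FiniteDom map
  open Snapshots public

  dom : Snapshots → Actor → Set
  dom Q A = ∃ λ Φ → map Q A ≡ just Φ

  _⊆Q_ : Snapshots → Snapshots → Set
  Q' ⊆Q Q = ∀ A → map Q' A ≡ nothing ⊎ map Q' A ≡ map Q A

  Nonempty : Snapshots → Set
  Nonempty Q = ∃ λ A → dom Q A

  DisjointDom : Snapshots → Snapshots → Set
  DisjointDom Q₁ Q₂ = ∀ A → ¬ (dom Q₁ A × dom Q₂ A)

  -- union of partial maps (left-biased; agrees with the union for disjoint domains)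
  orElse : Maybe Knowledge → Maybe Knowledge → Maybe Knowledge
  orElse (just Φ) _ = just Φ
  orElse nothing  m = m

  private
    ∪-finite : ∀ m₁ m₂ → FiniteDom m₁ → FiniteDom m₂ → FiniteDom (λ A → orElse (m₁ A) (m₂ A))
    ∪-finite m₁ m₂ (l₁ , f₁) (l₂ , f₂) = l₁ ++ l₂ , go
      where
        go : ∀ A Φ → orElse (m₁ A) (m₂ A) ≡ just Φ → A ∈ l₁ ++ l₂
        go A Φ eq with m₁ A in e
        ... | just Ψ  = ∈-++⁺ˡ (f₁ A Ψ e)
        ... | nothing = ∈-++⁺ʳ l₁ (f₂ A Φ eq)

  _∪Q_ : Snapshots → Snapshots → Snapshots
  Q₁ ∪Q Q₂ = snapshots (λ A → orElse (map Q₁ A) (map Q₂ A))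
                       (∪-finite (map Q₁) (map Q₂) (finite Q₁) (finite Q₂))

  _⊢at_∶_ : Snapshots → Actor → Fact → Set
  Q ⊢at A ∶ φ = ∃ λ Φ → map Q A ≡ just Φ × Φ ⊢ φ

  QActivated : Snapshots → Refob → Set
  QActivated Q r = Q ⊢at owner r ∶ Activated (token r)

  QSentCount : Snapshots → Refob → ℕ → Set
  QSentCount Q r n = Q ⊢at owner r ∶ SentCount (token r) n

  QCreatedUsing : Snapshots → Refob → Token → Set
  QCreatedUsing Q r y = Q ⊢at owner r ∶ CreatedUsing (token r) y

  QCreated : Snapshots → Refob → Set
  QCreated Q r = Q ⊢at target r ∶ Created (token r)

  QReleased : Snapshots → Refob → Set
  QReleased Q r = Q ⊢at target r ∶ Released (token r)

  QRecvCount : Snapshots → Refob → ℕ → Set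
  QRecvCount Q r n = Q ⊢at target r ∶ RecvCount (token r) n

  -- Chain(x): a sequence x₁,…,xₙ (all with target B) ending at x,
  -- rendered inductively (start = x₁, step = xᵢ ↦ xᵢ₊₁)
  data Chain (Q : Snapshots) : Refob → Set where
    start : ∀ {r} → QCreated Q r → ¬ QReleased Q r → Chain Q r
    step  : ∀ {r r'} → Chain Q r → target r' ≡ target r →
            QCreatedUsing Q r (token r') → ¬ QReleased Q r' → Chain Q r'

  Relevant : Snapshots → Refob → Set
  Relevant Q r = ∃ λ n → QActivated Q r × QSentCount Q r n × QRecvCount Q r n

  Finalized : Snapshots → Set
  Finalized Q = ∀ r → dom Q (target r) → Chain Q r → dom Q (owner r) × Relevant Q r

  data Path (Q : Snapshots) : Actor → Actor → Set where
    here  : ∀ {A} → Path Q A A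
    there : ∀ {A B} (r : Refob) → owner r ≡ A → Chain Q r → Path Q (target r) B → Path Q A B

  DependsOn : Snapshots → Actor → Actor → Set
  DependsOn Q B A = Path Q A B

  ActorFinalized : Snapshots → Actor → Set
  ActorFinalized Q C = ∀ B → DependsOn Q C B → ∀ r → target r ≡ B → Chain Q r → Relevant Q r

  PotentiallyFinalized : Snapshots → Actor → Set
  PotentiallyFinalized Q C =
    ∀ B → DependsOn Q C B → ∀ r → target r ≡ B → Chain Q r → Relevant Q r ⊎ ¬ dom Q (owner r)

  Receptionist : Snapshots → Actor → Set
  Receptionist Q B = dom Q B × (∃ λ r → target r ≡ B × Chain Q r × ¬ dom Q (owner r))

-- Everything that Q i knows it also knows inside the union Q₁ ∪ Q₂. Conversely, a chain
-- of the union ending in dom (Q i) is a chain of Q i unless some link of it has its owner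
-- outside dom (Q i), which makes the target a receptionist of Q i. Hence a dependency
-- path of the union into B either enters Q i through a receptionist R, so that B's
-- obligations there are R's, or runs entirely inside Q i, where potential finalization
-- of B leaves every chain with its owner in dom (Q i) relevant.
module Submission where

open import Defs
open import Data.Fin using (Fin; zero; suc)
open import Data.Product using (_×_; _,_; ∃)
open import Data.Sum using (_⊎_; inj₁; inj₂)
open import Data.Maybe using (just; nothing)
open import Data.Maybe.Properties using (just-injective)
open import Data.Empty using (⊥-elim)
open import Function using (_∘_)
open import Function.Bundles using (_⇔_; mk⇔)
open import Relation.Nullary using (¬_; Dec; yes; no)
open import Relation.Binary.PropositionalEquality using (_≡_; refl; sym; trans; subst)

module _ {Token Actor : Set} where
  open Model Token Actor

  dom? : (Q : Snapshots) (A : Actor) → Dec (dom Q A)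
  dom? Q A with map Q A
  ... | just Φ  = yes (Φ , refl)
  ... | nothing = no λ ()

  ⊢at⇒dom : ∀ Q A {φ} → Q ⊢at A ∶ φ → dom Q A
  ⊢at⇒dom _ _ (Φ , e , _) = Φ , e

  chain⇒dom-target : ∀ {Q r} → Chain Q r → dom Q (target r)
  chain⇒dom-target {Q} {r} (start c _) = ⊢at⇒dom Q (target r) c
  chain⇒dom-target {Q} (step ch eq _ _)  = subst (dom Q) (sym eq) (chain⇒dom-target ch)

  _++ᴾ_ : ∀ {Q A B C} → Path Q A B → Path Q B C → Path Q A C
  here           ++ᴾ q = q
  there r e ch p ++ᴾ q = there r e ch (p ++ᴾ q)

  _≼_ : Snapshots → Snapshots → Set
  Q' ≼ Q = ∀ A {Φ} → map Q' A ≡ just Φ → map Q A ≡ just Φ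

  ≼-∪ˡ : (Q₁ Q₂ : Snapshots) → Q₁ ≼ (Q₁ ∪Q Q₂)
  ≼-∪ˡ Q₁ Q₂ _ e rewrite e = refl

  ≼-∪ʳ : (Q₁ Q₂ : Snapshots) → DisjointDom Q₁ Q₂ → Q₂ ≼ (Q₁ ∪Q Q₂)
  ≼-∪ʳ Q₁ Q₂ disj A {Φ} e with map Q₁ A in e₁
  ... | just Ψ  = ⊥-elim (disj A ((Ψ , e₁) , (Φ , e)))
  ... | nothing = e

  ≼-∪ : (Q : Fin 2 → Snapshots) → DisjointDom (Q zero) (Q (suc zero)) →
        ∀ i → Q i ≼ (Q zero ∪Q Q (suc zero))
  ≼-∪ Q _    zero       = ≼-∪ˡ (Q zero) (Q (suc zero))
  ≼-∪ Q disj (suc zero) = ≼-∪ʳ (Q zero) (Q (suc zero)) disj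

  module Embedding {Q' Q : Snapshots} (Q'≼Q : Q' ≼ Q) where

    ⊢at-lift : ∀ {A φ} → Q' ⊢at A ∶ φ → Q ⊢at A ∶ φ
    ⊢at-lift {A} (Φ , e , d) = Φ , Q'≼Q A e , d

    ⊢at-lower : ∀ {A φ} → dom Q' A → Q ⊢at A ∶ φ → Q' ⊢at A ∶ φ
    ⊢at-lower {A} (Ψ , e) (Φ , e' , d) =
      Ψ , e , subst (_⊢ _) (just-injective (trans (sym e') (Q'≼Q A e))) d

    relevant-lift : ∀ {r} → Relevant Q' r → Relevant Q r
    relevant-lift (n , a , s , c) = n , ⊢at-lift a , ⊢at-lift s , ⊢at-lift c

    chain-lift : ∀ {r} → Chain Q' r → Chain Q r
    chain-lift {r} (start c nr) =
      start (⊢at-lift c) (nr ∘ ⊢at-lower (⊢at⇒dom Q' (target r) c))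
    chain-lift ch@(step ch₀ eq cu nr) =
      step (chain-lift ch₀) eq (⊢at-lift cu) (nr ∘ ⊢at-lower (chain⇒dom-target ch))

    path-lift : ∀ {A B} → Path Q' A B → Path Q A B
    path-lift here             = here
    path-lift (there r e ch p) = there r e (chain-lift ch) (path-lift p)

    chain-lower : ∀ {r} → Chain Q r → dom Q' (target r) →
                  Chain Q' r ⊎ Receptionist Q' (target r)
    chain-lower (start c nr) d = inj₁ (start (⊢at-lower d c) (nr ∘ ⊢at-lift))
    chain-lower (step {r} ch eq cu nr) d with chain-lower ch (subst (dom Q') eq d)
    ... | inj₂ rec = inj₂ (subst (Receptionist Q') (sym eq) rec)
    ... | inj₁ ch' with dom? Q' (owner r)
    ...   | yes dO = inj₁ (step ch' eq (⊢at-lower dO cu) (nr ∘ ⊢at-lift))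
    ...   | no ¬dO = inj₂ (d , r , sym eq , ch' , ¬dO)

    owned-chain-lower : ∀ {r} → Chain Q r → dom Q' (target r) →
                        (Chain Q' r × dom Q' (owner r)) ⊎ Receptionist Q' (target r)
    owned-chain-lower {r} ch d with chain-lower ch d
    ... | inj₂ rec = inj₂ rec
    ... | inj₁ ch' with dom? Q' (owner r)
    ...   | yes dO = inj₁ (ch' , dO)
    ...   | no ¬dO = inj₂ (d , r , refl , ch' , ¬dO)

    path-lower : ∀ {X T} → Path Q X T → dom Q' T →
                 (∃ λ R → Receptionist Q' R × Path Q' R T × Path Q X R)
                 ⊎ (dom Q' X × Path Q' X T)
    path-lower here d = inj₂ (d , here)
    path-lower (there r e ch p) d with path-lower p d
    ... | inj₁ (R , rec , pRT , pXR) = inj₁ (R , rec , pRT , there r e ch pXR)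
    ... | inj₂ (dY , pYT) with owned-chain-lower ch dY
    ...   | inj₁ (ch' , dO) = inj₂ (subst (dom Q') e dO , there r e ch' pYT)
    ...   | inj₂ rec        = inj₁ (target r , rec , pYT , there r e ch here)

theorem8p6 : (Token Actor : Set) → let open Model Token Actor in
    (Q : Fin 2 → Snapshots) →
    DisjointDom (Q zero) (Q (suc zero)) →
    (∀ j → ∀ (Q' : Snapshots) → Q' ⊆Q Q j → Nonempty Q' → ¬ Finalized Q') →
    (∀ j → ∀ A → dom (Q j) A → PotentiallyFinalized (Q j) A) →
    (i : Fin 2) → (B : Actor) → dom (Q i) B → ¬ Receptionist (Q i) B →
    ActorFinalized (Q zero ∪Q Q (suc zero)) B
    ⇔ (∀ R → Receptionist (Q i) R → DependsOn (Q i) B R →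
    ActorFinalized (Q zero ∪Q Q (suc zero)) R)
theorem8p6 Token Actor Q disj _ pot i B dB _ = mk⇔ restrict extend
  where
    open Model Token Actor
    open Embedding {Q' = Q i} {Q = Q zero ∪Q Q (suc zero)} (≼-∪ Q disj i)

    restrict : ActorFinalized _ B → ∀ R → Receptionist (Q i) R → DependsOn (Q i) B R →
               ActorFinalized _ R
    restrict fin R _ pRB X pXR = fin X (pXR ++ᴾ path-lift pRB)

    extend : (∀ R → Receptionist (Q i) R → DependsOn (Q i) B R → ActorFinalized _ R) →
             ActorFinalized _ B
    extend fin X pXB r refl ch with path-lower pXB dB
    ... | inj₁ (R , rec , pRB , pXR) = fin R rec pRB X pXR r refl ch
    ... | inj₂ (dX , pXB') with owned-chain-lower ch dX
    ...   | inj₂ rec = fin X rec pXB' X here r refl ch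
    ...   | inj₁ (ch' , dO) with pot i B dB X pXB' r refl ch'
    ...     | inj₁ rel = relevant-lift rel
    ...     | inj₂ ¬dO = ⊥-elim (¬dO dO)
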